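{- Let $G$ be a block graph and $B$ a block of $G$ with $t$ vertices. Assign the colors $1,\dots,t$ bijectively and arbitrarily to the vertices of $B$. Then this pre-coloring can be extended to a Grundy-coloring of $G$ using $\omega(G)$ colors.
   Context: Graphs are finite, simple, undirected. A block graph is a graph in which every block (maximal 2-connected subgraph or bridge) is a complete graph. $\omega(G)$ is the clique number. A Grundy-coloring of $G$ with $k$ colors is a proper coloring $c:V(G)\to\{1,\dots,k\}$ in which every color $1,\dots,k$ is used and, for all $i<j$, every vertex of color $j$ has a neighbour of color $i$. -}

module Defs where

open import Data.Nat using (ℕ; _≤_; _<_)
open import Data.Bool using (Bool; T; false)
open import Data.Vec using (_[_]≔_)
open import Data.Fin using (Fin)
open import Data.Fin.Subset using (Subset; _∈_; _∉_; _⊆_; ∣_∣)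
open import Data.Product using (Σ; ∃; _×_; _,_)
open import Relation.Binary.PropositionalEquality using (_≡_)
open import Relation.Nullary using (¬_)

record Graph : Set where
  field
    n      : ℕ
    adj    : Fin n → Fin n → Bool
    sym    : ∀ u v → adj u v ≡ adj v u
    irrefl : ∀ u → adj u u ≡ false

open Graph public

Vertex : Graph → Set
Vertex G = Fin (n G)

Edge : (G : Graph) → Vertex G → Vertex G → Set
Edge G u v = T (adj G u v)

data Reach (G : Graph) (S : Subset (n G)) : Vertex G → Vertex G → Set where
  here : ∀ {u} → u ∈ S → Reach G S u u
  step : ∀ {u w v} → u ∈ S → Edge G u w → Reach G S w v → Reach G S u v

Connected : (G : Graph) → Subset (n G) → Set
Connected G S = (∃ λ u → u ∈ S) × (∀ u v → u ∈ S → v ∈ S → Reach G S u v)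

_－_ : ∀ {m} → Subset m → Fin m → Subset m
S － x = S [ x ]≔ false

NoCutVertex : (G : Graph) → Subset (n G) → Set
NoCutVertex G S = ∀ x → x ∈ S → ∀ u v → u ∈ S → v ∈ S → ¬ (u ≡ x) → ¬ (v ≡ x)
                  → Reach G (S － x) u v

IsBlock : (G : Graph) → Subset (n G) → Set
IsBlock G S = Connected G S × NoCutVertex G S
              × (∀ S' → S ⊆ S' → Connected G S' → NoCutVertex G S' → S' ⊆ S)

IsClique : (G : Graph) → Subset (n G) → Set
IsClique G S = ∀ u v → u ∈ S → v ∈ S → ¬ (u ≡ v) → Edge G u v

IsBlockGraph : Graph → Set
IsBlockGraph G = ∀ S → IsBlock G S → IsClique G S

IsCliqueNumber : Graph → ℕ → Set
IsCliqueNumber G k = (∃ λ S → IsClique G S × ∣ S ∣ ≡ k)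
                     × (∀ S → IsClique G S → ∣ S ∣ ≤ k)

IsGrundyColoring : (G : Graph) → ℕ → (Vertex G → ℕ) → Set
IsGrundyColoring G k c =
    (∀ v → 1 ≤ c v × c v ≤ k)
  × (∀ u v → Edge G u v → ¬ (c u ≡ c v))
  × (∀ i → 1 ≤ i → i ≤ k → ∃ λ v → c v ≡ i)
  × (∀ i v → 1 ≤ i → i < c v → ∃ λ u → Edge G v u × c u ≡ i)

module Submission where

-- Extend the precolouring greedily, one vertex v at a time, giving v the least colour missing
-- from its already coloured neighbours. The coloured set P is kept reach-closed (vertices of P
-- joined in G are joined inside P) by choosing v adjacent to P whenever possible. Then any two
-- coloured neighbours of v are joined by a path inside P, which closes a cycle through v; a
-- cycle has no cut vertex, so it lies in a block, which is a clique. Hence v and its coloured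
-- neighbours form a clique, v has fewer than ω coloured neighbours, and some colour ≤ ω is free.
-- Finally, a maximum clique carries ω distinct colours, so colour ω occurs, and the Grundy
-- property makes every smaller colour occur too.

open import Data.Bool using (true; false; T)
open import Data.Bool.Properties using (T-≡)
open import Data.Empty using (⊥-elim)
open import Data.Fin using (Fin; zero; suc; _≟_)
open import Data.Fin.Properties using (any?)
open import Data.Fin.Subset using (Subset; _∈_; _∉_; _⊆_; _⊂_; _⊃_; _∪_; ⁅_⁆; ⊤; ∣_∣; Empty)
open import Data.Fin.Subset.Induction using (Acc; acc; ⊃-wellFounded)
open import Data.Fin.Subset.Properties
  using (_∈?_; ∈⊤; x∈⁅x⁆; x∈⁅y⁆⇒x≡y; x∈p∪q⁺; x∈p∪q⁻; p⊂q⇒∣p∣<∣q∣; Empty-unique; ∣⊥∣≡0)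
open import Data.List using (List; []; _∷_)
open import Data.List.Membership.Propositional using () renaming (_∈_ to _∈ₗ_; _∉_ to _∉ₗ_)
open import Data.List.Relation.Binary.Subset.Propositional using () renaming (_⊆_ to _⊆ₗ_)
open import Data.List.Relation.Unary.Any using (here; there)
open import Data.Nat using (ℕ; zero; suc; _≤_; _<_; z≤n; s≤s; s≤s⁻¹)
open import Data.Nat.Properties
  using (≤-refl; ≤-reflexive; ≤-trans; <⇒≤; <-irrefl; 1+n≰n; ≤∧≢⇒<; m<1+n⇒m≤n; m≤n⇒m≤1+n;
         m≤n⇒m<n∨m≡n; module ≤-Reasoning)
  renaming (_≟_ to _≟ℕ_)
open import Data.Product using (∃; ∃₂; _×_; _,_; proj₁; proj₂)
open import Data.Sum as Sum using (_⊎_; inj₁; inj₂)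
open import Data.Vec using (_∷_; tabulate; here; there)
open import Data.Vec.Functional using (updateAt)
open import Data.Vec.Functional.Properties using (updateAt-updates; updateAt-minimal)
open import Data.Vec.Properties using (lookup∘tabulate; []=⇒lookup; lookup⇒[]=)
open import Function using (id; const; _∘_; Equivalence)
open import Level using (Level)
open import Relation.Binary.PropositionalEquality using (_≡_; _≢_; refl; sym; trans; cong; subst)
open import Relation.Nullary using (¬_; Dec; yes; no)
open import Relation.Nullary.Decidable
  using (T?; ¬?; _×-dec_; _⊎-dec_; isYes; toWitness; fromWitness; decidable-stable)
open import Relation.Unary using (Pred; Decidable)

open import Defs hiding (sym)

m≤1+n∧m≢1+n⇒m≤n : ∀ {m n} → m ≤ suc n → m ≢ suc n → m ≤ n
m≤1+n∧m≢1+n⇒m≤n m≤1+n m≢1+n = m<1+n⇒m≤n (≤∧≢⇒< m≤1+n m≢1+n)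

first-gap : ∀ {ℓ} {P : Pred ℕ ℓ} → Decidable P → ∀ k
          → (∀ i → 1 ≤ i → i ≤ k → P i)
          ⊎ ∃ λ m → 1 ≤ m × m ≤ k × ¬ P m × (∀ i → 1 ≤ i → i < m → P i)
first-gap P? zero = inj₁ λ _ 1≤i i≤0 → ⊥-elim (1+n≰n (≤-trans 1≤i i≤0))
first-gap {P = P} P? (suc k) with first-gap P? k
... | inj₂ (m , 1≤m , m≤k , ¬Pm , below) = inj₂ (m , 1≤m , m≤n⇒m≤1+n m≤k , ¬Pm , below)
... | inj₁ upto-k with P? (suc k)
...   | no ¬Pk+1 =
  inj₂ (suc k , s≤s z≤n , ≤-refl , ¬Pk+1 , λ i 1≤i i<k+1 → upto-k i 1≤i (s≤s⁻¹ i<k+1))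
...   | yes Pk+1 = inj₁ upto-k+1
  where
  upto-k+1 : ∀ i → 1 ≤ i → i ≤ suc k → P i
  upto-k+1 i 1≤i i≤k+1 with m≤n⇒m<n∨m≡n i≤k+1
  ... | inj₁ i<k+1 = upto-k i 1≤i (s≤s⁻¹ i<k+1)
  ... | inj₂ refl  = Pk+1

x∈p∧x≢y⇒x∈p－y : ∀ {m} {p : Subset m} {x y} → x ∈ p → x ≢ y → x ∈ p － y
x∈p∧x≢y⇒x∈p－y {p = _ ∷ _} {x = zero}  {y = zero}  here      x≢y = ⊥-elim (x≢y refl)
x∈p∧x≢y⇒x∈p－y {p = _ ∷ _} {x = zero}  {y = suc y} here      _   = here
x∈p∧x≢y⇒x∈p－y {p = _ ∷ _} {x = suc x} {y = zero}  (there q) _   = there q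
x∈p∧x≢y⇒x∈p－y {p = _ ∷ _} {x = suc x} {y = suc y} (there q) x≢y =
  there (x∈p∧x≢y⇒x∈p－y q (x≢y ∘ cong suc))

x∈p－y⇒x∈p : ∀ {m} {p : Subset m} {x y} → x ∈ p － y → x ∈ p
x∈p－y⇒x∈p {p = _ ∷ _} {x = zero}  {y = suc y} here      = here
x∈p－y⇒x∈p {p = _ ∷ _} {x = suc x} {y = zero}  (there q) = there q
x∈p－y⇒x∈p {p = _ ∷ _} {x = suc x} {y = suc y} (there q) = there (x∈p－y⇒x∈p q)

x∈p－y⇒x≢y : ∀ {m} {p : Subset m} {x y} → x ∈ p － y → x ≢ y
x∈p－y⇒x≢y {p = _ ∷ _} {x = zero}  {y = suc y} here      ()
x∈p－y⇒x≢y {p = _ ∷ _} {x = suc x} {y = zero}  (there q) ()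
x∈p－y⇒x≢y {p = _ ∷ _} {x = suc x} {y = suc y} (there q) refl = x∈p－y⇒x≢y q refl

x∈p⇒∣p∣≡1+∣p－x∣ : ∀ {m} {p : Subset m} {x} → x ∈ p → ∣ p ∣ ≡ suc ∣ p － x ∣
x∈p⇒∣p∣≡1+∣p－x∣ {x = zero} here = refl
x∈p⇒∣p∣≡1+∣p－x∣ {p = true  ∷ p} {x = suc x} (there q) = cong suc (x∈p⇒∣p∣≡1+∣p－x∣ q)
x∈p⇒∣p∣≡1+∣p－x∣ {p = false ∷ p} {x = suc x} (there q) = x∈p⇒∣p∣≡1+∣p－x∣ q

module _ {m : ℕ} {ℓ : Level} {P : Pred (Fin m) ℓ} (P? : Decidable P) where

  toSubset : Subset m
  toSubset = tabulate (isYes ∘ P?)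

  ∈-toSubset⁺ : ∀ {x} → P x → x ∈ toSubset
  ∈-toSubset⁺ {x} px =
    lookup⇒[]= x toSubset (trans (lookup∘tabulate _ x) (Equivalence.to T-≡ (fromWitness px)))

  ∈-toSubset⁻ : ∀ {x} → x ∈ toSubset → P x
  ∈-toSubset⁻ {x} x∈ =
    toWitness (Equivalence.from T-≡ (trans (sym (lookup∘tabulate _ x)) ([]=⇒lookup x∈)))

module _ {m : ℕ} (f : Fin m → ℕ) where

  injective⇒∣p∣≤k : ∀ k (p : Subset m) → (∀ x → x ∈ p → 1 ≤ f x × f x ≤ k)
                  → (∀ x y → x ∈ p → y ∈ p → f x ≡ f y → x ≡ y) → ∣ p ∣ ≤ k
  injective⇒∣p∣≤k zero p range _ = ≤-reflexive (trans (cong ∣_∣ (Empty-unique p-empty)) (∣⊥∣≡0 m))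
    where
    p-empty : Empty p
    p-empty (x , x∈p) = let 1≤fx , fx≤0 = range x x∈p in 1+n≰n (≤-trans 1≤fx fx≤0)
  injective⇒∣p∣≤k (suc k) p range inj with any? (λ x → (x ∈? p) ×-dec (f x ≟ℕ suc k))
  ... | yes (x , x∈p , fx≡k+1) =
    subst (_≤ suc k) (sym (x∈p⇒∣p∣≡1+∣p－x∣ x∈p)) (s≤s (injective⇒∣p∣≤k k (p － x) range′ inj′))
    where
    range′ : ∀ y → y ∈ p － x → 1 ≤ f y × f y ≤ k
    range′ y y∈p－x =
      let y∈p = x∈p－y⇒x∈p y∈p－x
          1≤fy , fy≤k+1 = range y y∈p
      in 1≤fy , m≤1+n∧m≢1+n⇒m≤n fy≤k+1
                  (λ fy≡k+1 → x∈p－y⇒x≢y y∈p－x (inj y x y∈p x∈p (trans fy≡k+1 (sym fx≡k+1))))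
    inj′ : ∀ y z → y ∈ p － x → z ∈ p － x → f y ≡ f z → y ≡ z
    inj′ y z y∈ z∈ = inj y z (x∈p－y⇒x∈p y∈) (x∈p－y⇒x∈p z∈)
  ... | no ∄x = m≤n⇒m≤1+n (injective⇒∣p∣≤k k p range′ inj)
    where
    range′ : ∀ y → y ∈ p → 1 ≤ f y × f y ≤ k
    range′ y y∈p = let 1≤fy , fy≤k+1 = range y y∈p
                   in 1≤fy , m≤1+n∧m≢1+n⇒m≤n fy≤k+1 (λ fy≡k+1 → ∄x (y , y∈p , fy≡k+1))

  covering⇒k≤∣p∣ : ∀ k (p : Subset m) → (∀ i → 1 ≤ i → i ≤ k → ∃ λ x → x ∈ p × f x ≡ i) → k ≤ ∣ p ∣
  covering⇒k≤∣p∣ zero p _ = z≤n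
  covering⇒k≤∣p∣ (suc k) p cover with cover (suc k) (s≤s z≤n) ≤-refl
  ... | x , x∈p , fx≡k+1 =
    subst (suc k ≤_) (sym (x∈p⇒∣p∣≡1+∣p－x∣ x∈p)) (s≤s (covering⇒k≤∣p∣ k (p － x) cover′))
    where
    cover′ : ∀ i → 1 ≤ i → i ≤ k → ∃ λ y → y ∈ p － x × f y ≡ i
    cover′ i 1≤i i≤k with cover i 1≤i (m≤n⇒m≤1+n i≤k)
    ... | y , y∈p , fy≡i = y , x∈p∧x≢y⇒x∈p－y y∈p y≢x , fy≡i
      where
      y≢x : y ≢ x
      y≢x refl = 1+n≰n (subst (_≤ k) (trans (sym fy≡i) fx≡k+1) i≤k)

module _ (G : Graph) where

  open import Data.List.Membership.DecPropositional (_≟_ {n G}) using () renaming (_∈?_ to _∈ₗ?_)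

  edge-sym : ∀ {u v} → Edge G u v → Edge G v u
  edge-sym {u} {v} = subst T (Graph.sym G u v)

  edge⇒≢ : ∀ {u v} → Edge G u v → u ≢ v
  edge⇒≢ {u} e refl = subst T (irrefl G u) e

  edge? : ∀ u v → Dec (Edge G u v)
  edge? u v = T? (adj G u v)

  module _ {S : Subset (n G)} where

    reach-trans : ∀ {u v w} → Reach G S u v → Reach G S v w → Reach G S u w
    reach-trans (here _)       r′ = r′
    reach-trans (step u∈S e r) r′ = step u∈S e (reach-trans r r′)

    reach-snoc : ∀ {u v w} → Reach G S u v → Edge G v w → w ∈ S → Reach G S u w
    reach-snoc (here v∈S)     e  w∈S = step v∈S e (here w∈S)
    reach-snoc (step u∈S e r) e′ w∈S = step u∈S e (reach-snoc r e′ w∈S)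

    reach-sym : ∀ {u v} → Reach G S u v → Reach G S v u
    reach-sym (here u∈S)     = here u∈S
    reach-sym (step u∈S e r) = reach-snoc (reach-sym r) (edge-sym e) u∈S

  reach-mono : ∀ {S S′ u v} → S ⊆ S′ → Reach G S u v → Reach G S′ u v
  reach-mono S⊆S′ (here u∈S)     = here (S⊆S′ u∈S)
  reach-mono S⊆S′ (step u∈S e r) = step (S⊆S′ u∈S) e (reach-mono S⊆S′ r)

  reach⇒boundary-edge : ∀ {S P u b} → Reach G S u b → u ∉ P → b ∈ P
                      → ∃ λ w → w ∉ P × ∃ λ p → p ∈ P × Edge G w p
  reach⇒boundary-edge (here _) u∉P u∈P = ⊥-elim (u∉P u∈P)
  reach⇒boundary-edge {P = P} (step {w = w} _ uw w⇝b) u∉P b∈P with w ∈? P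
  ... | yes w∈P = _ , u∉P , w , w∈P , uw
  ... | no  w∉P = reach⇒boundary-edge w⇝b w∉P b∈P

  data Path : Vertex G → Vertex G → List (Vertex G) → Set where
    stop : ∀ {a} → Path a a (a ∷ [])
    hop  : ∀ {a w b L} → Edge G a w → a ∉ₗ L → Path w b L → Path a b (a ∷ L)

  path-head : ∀ {a b L} → Path a b L → a ∈ₗ L
  path-head stop        = here refl
  path-head (hop _ _ _) = here refl

  path-last : ∀ {a b L} → Path a b L → b ∈ₗ L
  path-last stop        = here refl
  path-last (hop _ _ π) = there (path-last π)

  path-suffix : ∀ {a w b L} → Path w b L → a ∈ₗ L → ∃ λ L′ → Path a b L′ × L′ ⊆ₗ L
  path-suffix π@stop        (here refl) = _ , π , id
  path-suffix π@(hop _ _ _) (here refl) = _ , π , id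
  path-suffix (hop _ _ π)   (there a∈L) =
    let L′ , π′ , L′⊆L = path-suffix π a∈L in L′ , π′ , there ∘ L′⊆L

  reach⇒path : ∀ {S a b} → Reach G S a b → ∃ λ L → Path a b L × (∀ {y} → y ∈ₗ L → y ∈ S)
  reach⇒path (here a∈S) = _ , stop , λ { (here refl) → a∈S }
  reach⇒path {a = a} (step a∈S e r) with reach⇒path r
  ... | L , π , L⊆S with a ∈ₗ? L
  ...   | yes a∈L = let L′ , π′ , L′⊆L = path-suffix π a∈L in L′ , π′ , L⊆S ∘ L′⊆L
  ...   | no  a∉L = a ∷ L , hop e a∉L π , λ { (here refl) → a∈S ; (there y∈L) → L⊆S y∈L }

  module _ {U : Subset (n G)} where

    path⇒reach-source : ∀ {a b L u} → Path a b L → (∀ {y} → y ∈ₗ L → y ∈ U) → u ∈ₗ L → Reach G U u a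
    path⇒reach-source stop        L⊆U (here refl) = here (L⊆U (here refl))
    path⇒reach-source (hop _ _ _) L⊆U (here refl) = here (L⊆U (here refl))
    path⇒reach-source (hop e _ π) L⊆U (there u∈L) =
      reach-snoc (path⇒reach-source π (L⊆U ∘ there) u∈L) (edge-sym e) (L⊆U (here refl))

    path⇒reach-target : ∀ {a b L u} → Path a b L → (∀ {y} → y ∈ₗ L → y ∈ U) → u ∈ₗ L → Reach G U u b
    path⇒reach-target stop        L⊆U (here refl) = here (L⊆U (here refl))
    path⇒reach-target (hop e _ π) L⊆U (here refl) =
      step (L⊆U (here refl)) e (path⇒reach-target π (L⊆U ∘ there) (path-head π))
    path⇒reach-target (hop _ _ π) L⊆U (there u∈L) = path⇒reach-target π (L⊆U ∘ there) u∈L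

    -- On a simple path x cannot lie both before and after u, so u reaches one end avoiding x.
    path-avoiding : ∀ {a b L u x} → Path a b L → (∀ {y} → y ∈ₗ L → y ≢ x → y ∈ U) → u ∈ₗ L → u ≢ x
                  → Reach G U u a ⊎ Reach G U u b
    path-avoiding stop        L∖x⊆U (here refl) u≢x = inj₁ (here (L∖x⊆U (here refl) u≢x))
    path-avoiding (hop _ _ _) L∖x⊆U (here refl) u≢x = inj₁ (here (L∖x⊆U (here refl) u≢x))
    path-avoiding {a = a} {x = x} (hop e a∉L π) L∖x⊆U (there u∈L) u≢x with a ≟ x
    ... | yes refl = inj₂ (path⇒reach-target π (λ y∈L → L∖x⊆U (there y∈L) λ { refl → a∉L y∈L }) u∈L)
    ... | no  a≢x with path-avoiding π (L∖x⊆U ∘ there) u∈L u≢x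
    ...   | inj₁ u⇝w = inj₁ (reach-snoc u⇝w (edge-sym e) (L∖x⊆U (here refl) a≢x))
    ...   | inj₂ u⇝b = inj₂ u⇝b

  cycle : Vertex G → List (Vertex G) → Subset (n G)
  cycle v L = toSubset (λ y → (y ≟ v) ⊎-dec (y ∈ₗ? L))

  module _ {v a b L} (π : Path a b L) (v∉L : v ∉ₗ L) (va : Edge G v a) (vb : Edge G v b) where

    private
      C : Subset (n G)
      C = cycle v L

      v∈C : v ∈ C
      v∈C = ∈-toSubset⁺ _ (inj₁ refl)

      L⊆C : ∀ {y} → y ∈ₗ L → y ∈ C
      L⊆C y∈L = ∈-toSubset⁺ _ (inj₂ y∈L)

    cycle-connected : Connected G C
    cycle-connected = (v , v∈C) , λ u w u∈C w∈C → reach-trans (to-v u∈C) (reach-sym (to-v w∈C))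
      where
      to-v : ∀ {u} → u ∈ C → Reach G C u v
      to-v u∈C with ∈-toSubset⁻ _ u∈C
      ... | inj₁ refl = here v∈C
      ... | inj₂ u∈L  = reach-snoc (path⇒reach-source π L⊆C u∈L) (edge-sym va) v∈C

    cycle-hub : ∀ x → ∃ λ h → ∀ {u} → u ∈ C → u ≢ x → Reach G (C － x) u h
    cycle-hub x with x ≟ v
    ... | yes refl = a , to-a
      where
      to-a : ∀ {u} → u ∈ C → u ≢ v → Reach G (C － v) u a
      to-a u∈C u≢v with ∈-toSubset⁻ _ u∈C
      ... | inj₁ u≡v = ⊥-elim (u≢v u≡v)
      ... | inj₂ u∈L =
        path⇒reach-source π (λ y∈L → x∈p∧x≢y⇒x∈p－y (L⊆C y∈L) λ { refl → v∉L y∈L }) u∈L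
    ... | no x≢v = v , to-v
      where
      v∈C－x : v ∈ C － x
      v∈C－x = x∈p∧x≢y⇒x∈p－y v∈C (x≢v ∘ sym)
      to-v : ∀ {u} → u ∈ C → u ≢ x → Reach G (C － x) u v
      to-v u∈C u≢x with ∈-toSubset⁻ _ u∈C
      ... | inj₁ refl = here v∈C－x
      ... | inj₂ u∈L with path-avoiding π (λ y∈L y≢x → x∈p∧x≢y⇒x∈p－y (L⊆C y∈L) y≢x) u∈L u≢x
      ...   | inj₁ u⇝a = reach-snoc u⇝a (edge-sym va) v∈C－x
      ...   | inj₂ u⇝b = reach-snoc u⇝b (edge-sym vb) v∈C－x

    cycle-noCutVertex : NoCutVertex G C
    cycle-noCutVertex x _ u w u∈C w∈C u≢x w≢x =
      let h , to-h = cycle-hub x in reach-trans (to-h u∈C u≢x) (reach-sym (to-h w∈C w≢x))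

  extends-to-block : ∀ {S} → Connected G S → NoCutVertex G S → ¬ ¬ ∃ λ B → S ⊆ B × IsBlock G B
  extends-to-block = go (⊃-wellFounded _)
    where
    go : ∀ {S} → Acc _⊃_ S → Connected G S → NoCutVertex G S → ¬ ¬ ∃ λ B → S ⊆ B × IsBlock G B
    go {S} (acc larger) conn ncv no-block = no-block (S , id , conn , ncv , maximal)
      where
      maximal : ∀ S′ → S ⊆ S′ → Connected G S′ → NoCutVertex G S′ → S′ ⊆ S
      maximal S′ S⊆S′ conn′ ncv′ {x} x∈S′ with x ∈? S
      ... | yes x∈S = x∈S
      ... | no  x∉S = ⊥-elim (go (larger (S⊆S′ , x , x∈S′ , x∉S)) conn′ ncv′
                        λ (B , S′⊆B , B-block) → no-block (B , S′⊆B ∘ S⊆S′ , B-block))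

  module _ (block-graph : IsBlockGraph G) where

    -- extends-to-block only gives a double negation, which suffices because adjacency is decidable.
    connected∧noCutVertex⇒clique : ∀ {S} → Connected G S → NoCutVertex G S → IsClique G S
    connected∧noCutVertex⇒clique conn ncv u v u∈S v∈S u≢v = decidable-stable (edge? u v) λ ¬uv →
      extends-to-block conn ncv λ (B , S⊆B , B-block) →
        ¬uv (block-graph B B-block u v (S⊆B u∈S) (S⊆B v∈S) u≢v)

    joined-avoiding⇒adjacent : ∀ {T v a b} → v ∉ T → Edge G v a → Edge G v b → a ≢ b
                             → Reach G T a b → Edge G a b
    joined-avoiding⇒adjacent {v = v} v∉T va vb a≢b a⇝b =
      let L , π , L⊆T = reach⇒path a⇝b
          v∉L : v ∉ₗ L
          v∉L = v∉T ∘ L⊆T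
      in connected∧noCutVertex⇒clique (cycle-connected π v∉L va vb) (cycle-noCutVertex π v∉L va vb)
           _ _ (∈-toSubset⁺ _ (inj₂ (path-head π))) (∈-toSubset⁺ _ (inj₂ (path-last π))) a≢b

  top-colour-used : ∀ {k} {c : Vertex G → ℕ} → 1 ≤ k → (∀ v → 1 ≤ c v × c v ≤ k)
                  → (∀ u v → Edge G u v → c u ≢ c v) → (∃ λ S → IsClique G S × ∣ S ∣ ≡ k)
                  → ∃ λ v → c v ≡ k
  top-colour-used {suc k} {c} _ range proper (S , S-clique , ∣S∣≡k+1) with any? (λ v → c v ≟ℕ suc k)
  ... | yes used  = used
  ... | no unused = ⊥-elim (1+n≰n (subst (_≤ k) ∣S∣≡k+1 (injective⇒∣p∣≤k c k S range′ injective)))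
    where
    range′ : ∀ x → x ∈ S → 1 ≤ c x × c x ≤ k
    range′ x _ = let 1≤cx , cx≤k+1 = range x
                 in 1≤cx , m≤1+n∧m≢1+n⇒m≤n cx≤k+1 (λ cx≡k+1 → unused (x , cx≡k+1))
    injective : ∀ x y → x ∈ S → y ∈ S → c x ≡ c y → x ≡ y
    injective x y x∈S y∈S cx≡cy =
      decidable-stable (x ≟ y) λ x≢y → proper x y (S-clique x y x∈S y∈S x≢y) cx≡cy

module Greedy (G : Graph) (block-graph : IsBlockGraph G) (ω : ℕ)
              (clique≤ω : ∀ S → IsClique G S → ∣ S ∣ ≤ ω) where

  ReachClosed : Subset (n G) → Set
  ReachClosed P = ∀ {a b} → a ∈ P → b ∈ P → Reach G ⊤ a b → Reach G P a b

  record PartialGrundy (P : Subset (n G)) (c : Vertex G → ℕ) : Set where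
    field
      range  : ∀ {v} → v ∈ P → 1 ≤ c v × c v ≤ ω
      proper : ∀ {u v} → u ∈ P → v ∈ P → Edge G u v → c u ≢ c v
      grundy : ∀ {i v} → v ∈ P → 1 ≤ i → i < c v → ∃ λ u → u ∈ P × Edge G v u × c u ≡ i

  clique-precolouring : ∀ {B pre} → IsClique G B
                      → (∀ v → v ∈ B → 1 ≤ pre v × pre v ≤ ∣ B ∣)
                      → (∀ u v → u ∈ B → v ∈ B → pre u ≡ pre v → u ≡ v)
                      → (∀ i → 1 ≤ i → i ≤ ∣ B ∣ → ∃ λ v → v ∈ B × pre v ≡ i)
                      → PartialGrundy B pre
  clique-precolouring {B} {pre} B-clique pre-range pre-injective pre-onto = record
    { range  = λ {v} v∈B →
        let 1≤pv , pv≤∣B∣ = pre-range v v∈B in 1≤pv , ≤-trans pv≤∣B∣ (clique≤ω B B-clique)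
    ; proper = λ {u} {v} u∈B v∈B uv pu≡pv → edge⇒≢ G uv (pre-injective u v u∈B v∈B pu≡pv)
    ; grundy = grundy′
    }
    where
    grundy′ : ∀ {i v} → v ∈ B → 1 ≤ i → i < pre v → ∃ λ u → u ∈ B × Edge G v u × pre u ≡ i
    grundy′ {i} {v} v∈B 1≤i i<pv =
      let u , u∈B , pu≡i = pre-onto i 1≤i (≤-trans (<⇒≤ i<pv) (proj₂ (pre-range v v∈B)))
          v≢u : v ≢ u
          v≢u v≡u = <-irrefl (trans (sym pu≡i) (cong pre (sym v≡u))) i<pv
      in u , u∈B , B-clique v u v∈B u∈B v≢u , pu≡i

  module _ {P : Subset (n G)} {v : Vertex G} where

    ∈-insert⁺ˡ : ∀ {y} → y ∈ P → y ∈ P ∪ ⁅ v ⁆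
    ∈-insert⁺ˡ y∈P = x∈p∪q⁺ (inj₁ y∈P)

    ∈-insert⁺ʳ : v ∈ P ∪ ⁅ v ⁆
    ∈-insert⁺ʳ = x∈p∪q⁺ (inj₂ (x∈⁅x⁆ v))

    ∈-insert⁻ : ∀ {y} → y ∈ P ∪ ⁅ v ⁆ → y ∈ P ⊎ y ≡ v
    ∈-insert⁻ y∈ = Sum.map₂ (x∈⁅y⁆⇒x≡y v) (x∈p∪q⁻ P ⁅ v ⁆ y∈)

  module _ {P : Subset (n G)} {c : Vertex G → ℕ} (closed : ReachClosed P) (pg : PartialGrundy P c)
           {v : Vertex G} (v∉P : v ∉ P) where

    open PartialGrundy pg

    NeighbourColour : ℕ → Set
    NeighbourColour i = ∃ λ u → u ∈ P × Edge G v u × c u ≡ i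

    neighbourColour? : ∀ i → Dec (NeighbourColour i)
    neighbourColour? i = any? λ u → (u ∈? P) ×-dec edge? G v u ×-dec (c u ≟ℕ i)

    private
      N N⁺ : Subset (n G)
      N  = toSubset λ u → (u ∈? P) ×-dec edge? G v u
      N⁺ = toSubset λ u → (u ≟ v) ⊎-dec ((u ∈? P) ×-dec edge? G v u)

    -- Two neighbours of v in P are joined through v, hence inside P, which avoids v.
    neighbourhood-clique : IsClique G N⁺
    neighbourhood-clique u w u∈ w∈ u≢w with ∈-toSubset⁻ _ u∈ | ∈-toSubset⁻ _ w∈
    ... | inj₁ refl       | inj₁ refl       = ⊥-elim (u≢w refl)
    ... | inj₁ refl       | inj₂ (_ , vw)   = vw
    ... | inj₂ (_ , vu)   | inj₁ refl       = edge-sym G vu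
    ... | inj₂ (u∈P , vu) | inj₂ (w∈P , vw) =
      joined-avoiding⇒adjacent G block-graph v∉P vu vw u≢w
        (closed u∈P w∈P (step ∈⊤ (edge-sym G vu) (step ∈⊤ vw (here ∈⊤))))

    free-colour : ∃ λ m → 1 ≤ m × m ≤ ω × ¬ NeighbourColour m
                        × (∀ i → 1 ≤ i → i < m → NeighbourColour i)
    free-colour with first-gap neighbourColour? ω
    ... | inj₂ gap      = gap
    ... | inj₁ all-used = ⊥-elim (1+n≰n (begin
      suc ω      ≤⟨ s≤s (covering⇒k≤∣p∣ c ω N cover) ⟩
      suc ∣ N ∣  ≤⟨ p⊂q⇒∣p∣<∣q∣ N⊂N⁺ ⟩
      ∣ N⁺ ∣     ≤⟨ clique≤ω N⁺ neighbourhood-clique ⟩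
      ω          ∎))
      where
      open ≤-Reasoning
      cover : ∀ i → 1 ≤ i → i ≤ ω → ∃ λ u → u ∈ N × c u ≡ i
      cover i 1≤i i≤ω =
        let u , u∈P , vu , cu≡i = all-used i 1≤i i≤ω in u , ∈-toSubset⁺ _ (u∈P , vu) , cu≡i
      N⊂N⁺ : N ⊂ N⁺
      N⊂N⁺ = (λ u∈N → ∈-toSubset⁺ _ (inj₂ (∈-toSubset⁻ _ u∈N))) , v , ∈-toSubset⁺ _ (inj₁ refl) ,
             λ v∈N → v∉P (proj₁ (∈-toSubset⁻ _ v∈N))

    private
      recolour-on-P : ∀ {m y} → y ∈ P → updateAt c v (const m) y ≡ c y
      recolour-on-P {y = y} y∈P = updateAt-minimal y v c λ { refl → v∉P y∈P }

    module _ {m : ℕ} (1≤m : 1 ≤ m) (m≤ω : m ≤ ω) (m-free : ¬ NeighbourColour m)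
             (below-used : ∀ i → 1 ≤ i → i < m → NeighbourColour i) where

      private
        c′ : Vertex G → ℕ
        c′ = updateAt c v (const m)

        c′-at-v : c′ v ≡ m
        c′-at-v = updateAt-updates v c

        neighbour≢m : ∀ {u} → u ∈ P → Edge G v u → c′ u ≢ m
        neighbour≢m u∈P vu cu≡m = m-free (_ , u∈P , vu , trans (sym (recolour-on-P u∈P)) cu≡m)

        lift : ∀ {y i} → (∃ λ u → u ∈ P × Edge G y u × c u ≡ i)
             → ∃ λ u → u ∈ P ∪ ⁅ v ⁆ × Edge G y u × c′ u ≡ i
        lift (u , u∈P , yu , cu≡i) = u , ∈-insert⁺ˡ u∈P , yu , trans (recolour-on-P u∈P) cu≡i

      insert-partialGrundy : PartialGrundy (P ∪ ⁅ v ⁆) c′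
      insert-partialGrundy = record { range = range′ ; proper = proper′ ; grundy = grundy′ }
        where
        range′ : ∀ {y} → y ∈ P ∪ ⁅ v ⁆ → 1 ≤ c′ y × c′ y ≤ ω
        range′ y∈ with ∈-insert⁻ y∈
        ... | inj₁ y∈P  = subst (λ k → 1 ≤ k × k ≤ ω) (sym (recolour-on-P y∈P)) (range y∈P)
        ... | inj₂ refl = subst (λ k → 1 ≤ k × k ≤ ω) (sym c′-at-v) (1≤m , m≤ω)

        proper′ : ∀ {u w} → u ∈ P ∪ ⁅ v ⁆ → w ∈ P ∪ ⁅ v ⁆ → Edge G u w → c′ u ≢ c′ w
        proper′ u∈ w∈ uw with ∈-insert⁻ u∈ | ∈-insert⁻ w∈
        ... | inj₁ u∈P  | inj₁ w∈P  = λ c′u≡c′w →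
          proper u∈P w∈P uw (trans (sym (recolour-on-P u∈P)) (trans c′u≡c′w (recolour-on-P w∈P)))
        ... | inj₁ u∈P  | inj₂ refl = λ c′u≡c′v →
          neighbour≢m u∈P (edge-sym G uw) (trans c′u≡c′v c′-at-v)
        ... | inj₂ refl | inj₁ w∈P  = λ c′v≡c′w →
          neighbour≢m w∈P uw (trans (sym c′v≡c′w) c′-at-v)
        ... | inj₂ refl | inj₂ refl = ⊥-elim (edge⇒≢ G uw refl)

        grundy′ : ∀ {i y} → y ∈ P ∪ ⁅ v ⁆ → 1 ≤ i → i < c′ y
                → ∃ λ u → u ∈ P ∪ ⁅ v ⁆ × Edge G y u × c′ u ≡ i
        grundy′ y∈ 1≤i i<c′y with ∈-insert⁻ y∈
        ... | inj₁ y∈P  = lift (grundy y∈P 1≤i (subst (_ <_) (recolour-on-P y∈P) i<c′y))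
        ... | inj₂ refl = lift (below-used _ 1≤i (subst (_ <_) c′-at-v i<c′y))

    insert-colour : ∃ λ c′ → PartialGrundy (P ∪ ⁅ v ⁆) c′ × (∀ {y} → y ∈ P → c′ y ≡ c y)
    insert-colour =
      let m , 1≤m , m≤ω , m-free , below-used = free-colour
      in updateAt c v (const m) , insert-partialGrundy 1≤m m≤ω m-free below-used , recolour-on-P

  Attachable : Subset (n G) → Vertex G → Set
  Attachable P v = (∃ λ p → p ∈ P × Edge G v p) ⊎ (∀ {b} → b ∈ P → ¬ Reach G ⊤ v b)

  attachable⇒reach : ∀ {P v b} → ReachClosed P → Attachable P v → b ∈ P → Reach G ⊤ v b
                   → Reach G (P ∪ ⁅ v ⁆) v b
  attachable⇒reach closed (inj₁ (p , p∈P , vp)) b∈P v⇝b =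
    step ∈-insert⁺ʳ vp (reach-mono G ∈-insert⁺ˡ (closed p∈P b∈P (step ∈⊤ (edge-sym G vp) v⇝b)))
  attachable⇒reach _ (inj₂ unreachable) b∈P v⇝b = ⊥-elim (unreachable b∈P v⇝b)

  insert-reachClosed : ∀ {P v} → ReachClosed P → Attachable P v → ReachClosed (P ∪ ⁅ v ⁆)
  insert-reachClosed closed attachable a∈ b∈ a⇝b with ∈-insert⁻ a∈ | ∈-insert⁻ b∈
  ... | inj₁ a∈P  | inj₁ b∈P  = reach-mono G ∈-insert⁺ˡ (closed a∈P b∈P a⇝b)
  ... | inj₂ refl | inj₁ b∈P  = attachable⇒reach closed attachable b∈P a⇝b
  ... | inj₁ a∈P  | inj₂ refl =
    reach-sym G (attachable⇒reach closed attachable a∈P (reach-sym G a⇝b))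
  ... | inj₂ refl | inj₂ refl = here ∈-insert⁺ʳ

  next-vertex : ∀ P → (∀ v → v ∈ P) ⊎ ∃ λ v → v ∉ P × Attachable P v
  next-vertex P with any? (λ v → ¬? (v ∈? P))
  ... | no ∄v = inj₁ λ v → decidable-stable (v ∈? P) λ v∉P → ∄v (v , v∉P)
  ... | yes (v₀ , v₀∉P) with any? (λ v → ¬? (v ∈? P) ×-dec any? λ p → (p ∈? P) ×-dec edge? G v p)
  ...   | yes (v , v∉P , adjacent) = inj₂ (v , v∉P , inj₁ adjacent)
  ...   | no ∄edge =
    inj₂ (v₀ , v₀∉P , inj₂ λ b∈P v₀⇝b → ∄edge (reach⇒boundary-edge G v₀⇝b v₀∉P b∈P))

  extend : ∀ {P c} → ReachClosed P → PartialGrundy P c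
         → ∃₂ λ Q c′ → (∀ v → v ∈ Q) × PartialGrundy Q c′ × (∀ {y} → y ∈ P → c′ y ≡ c y)
  extend = go (⊃-wellFounded _)
    where
    go : ∀ {P c} → Acc _⊃_ P → ReachClosed P → PartialGrundy P c
       → ∃₂ λ Q c′ → (∀ v → v ∈ Q) × PartialGrundy Q c′ × (∀ {y} → y ∈ P → c′ y ≡ c y)
    go {P} {c} (acc larger) closed pg with next-vertex P
    ... | inj₁ all = P , c , all , pg , λ _ → refl
    ... | inj₂ (v , v∉P , attachable) =
      let c′ , pg′ , c′≡c = insert-colour closed pg v∉P
          Q , c″ , all , pg″ , c″≡c′ = go (larger (∈-insert⁺ˡ , v , ∈-insert⁺ʳ , v∉P))
                                         (insert-reachClosed closed attachable) pg′
      in Q , c″ , all , pg″ , λ y∈P → trans (c″≡c′ (∈-insert⁺ˡ y∈P)) (c′≡c y∈P)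

  total⇒grundy : ∀ {P c} → (∃ λ S → IsClique G S × ∣ S ∣ ≡ ω) → (∀ v → v ∈ P) → PartialGrundy P c
               → IsGrundyColoring G ω c
  total⇒grundy {c = c} ω-clique all pg =
    (range ∘ all) , proper′ , onto ,
    λ i v 1≤i i<cv → let u , _ , vu , cu≡i = grundy (all v) 1≤i i<cv in u , vu , cu≡i
    where
    open PartialGrundy pg
    proper′ : ∀ u v → Edge G u v → c u ≢ c v
    proper′ u v = proper (all u) (all v)
    onto : ∀ i → 1 ≤ i → i ≤ ω → ∃ λ v → c v ≡ i
    onto i 1≤i i≤ω with top-colour-used G (≤-trans 1≤i i≤ω) (range ∘ all) proper′ ω-clique
    ... | v , cv≡ω with m≤n⇒m<n∨m≡n i≤ω
    ...   | inj₂ refl = v , cv≡ω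
    ...   | inj₁ i<ω  =
      let u , _ , _ , cu≡i = grundy (all v) 1≤i (subst (i <_) (sym cv≡ω) i<ω) in u , cu≡i

lemma1 : (G : Graph) → IsBlockGraph G → (ω : ℕ) → IsCliqueNumber G ω
           → (B : Subset (n G)) → IsBlock G B
           → (pre : Vertex G → ℕ)
           → (∀ v → v ∈ B → 1 ≤ pre v × pre v ≤ ∣ B ∣)
           → (∀ u v → u ∈ B → v ∈ B → pre u ≡ pre v → u ≡ v)
           → (∀ i → 1 ≤ i → i ≤ ∣ B ∣ → ∃ λ v → v ∈ B × pre v ≡ i)
           → ∃ λ (c : Vertex G → ℕ) → IsGrundyColoring G ω c
               × (∀ v → v ∈ B → c v ≡ pre v)
lemma1 G block-graph ω (ω-clique , clique≤ω) B B-block@((_ , B-connected) , _)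
       pre pre-range pre-injective pre-onto =
  let B-closed : ReachClosed B
      B-closed a∈B b∈B _ = B-connected _ _ a∈B b∈B
      B-precoloured = clique-precolouring (block-graph B B-block) pre-range pre-injective pre-onto
      _ , c , all , pg , c≡pre = extend B-closed B-precoloured
  in c , total⇒grundy ω-clique all pg , λ v v∈B → c≡pre v∈B
  where open Greedy G block-graph ω clique≤ω
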